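{- Let $k\ge 2$ be fixed and let symbol codes be drawn from $\{1,\dots,k\}$. For a sequence $(a_1,\dots,a_m)$ with $a_i\in\{1,\dots,k\}$, define its right-nested carryless-pairing code by $t_1=a_m$ and $t_{j+1}=\pi(a_{m-j},t_j)$ for $j=1,\dots,m-1$, the final code being the result after all $m-1$ pairings. Then the worst-case number of decimal digits of this code, over all sequences of length $m$ with entries in $\{1,\dots,k\}$, is $\Theta(2^m)$ as $m\to\infty$.
   Context: $F_n$ is the Fibonacci sequence ($F_0=0$, $F_1=1$, $F_{n+2}=F_{n+1}+F_n$). For $n\ge1$, $Z(n)$ is the Zeckendorf support of $n$: the unique set $\{e_1>\dots>e_s\}$ with $e_s\ge2$, $e_i-e_{i+1}\ge 2$, and $n=\sum F_{e_i}$; $Z(0)=\varnothing$. For $x\in\mathbb{N}$ let $r(x)=\min\{e:F_e>x\}$ (the rank), $B(x)=2r(x)$ (the delimiter), and for $y\ge1$ let $R(y)=\max Z(y)$. Rosko's carryless pairing $\pi:\mathbb{N}^2\to\mathbb{N}$ places the support of $x$ in an even band and that of $y$ in an odd band above the delimiter: $\pi(x,y)=\sum_{e\in Z(x)}F_{2e}+\sum_{j\in Z(y)}F_{B(x)+2j-1}$; in particular, for $y\ge1$ the largest index in $Z(\pi(x,y))$ is $B(x)+2R(y)-1$. -}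

module Defs where

open import Data.Nat using (ℕ; zero; suc; _+_; _*_; _∸_; _<ᵇ_; _⊔_)
open import Data.Bool using (if_then_else_)
open import Data.List using (List; []; _∷_; [_]; map; length; concatMap; foldr)
open import Data.Nat.ListAction using (sum)
open import Data.Vec using (Vec; _∷_) renaming ([] to []ᵥ)
open import Data.Fin using (Fin; toℕ)
open import Data.Fin.Base using () renaming (zero to fzero)
open import Data.Digit using (toNatDigits)
import Data.List as L

F : ℕ → ℕ
F zero = 0
F (suc zero) = 1
F (suc (suc n)) = F (suc n) + F n

-- rank r(x) = min { e : F e > x }.  Search upward from e with fuel;
-- F e > x holds for some e ≤ x + 2, so fuel x + 3 suffices.
rankFrom : ℕ → ℕ → ℕ → ℕ
rankFrom zero      e x = e
rankFrom (suc fuel) e x = if x <ᵇ F e then e else rankFrom fuel (suc e) x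

r : ℕ → ℕ
r x = rankFrom (x + 3) 0 x

B : ℕ → ℕ
B x = 2 * r x

-- Zeckendorf support Z(n), listed in decreasing order, computed by the
-- greedy algorithm: the largest index is e = r(n) - 1 (largest e with F e ≤ n),
-- then recurse on n - F e.  Fuel n suffices since F e ≥ 1 at each step.
Zfuel : ℕ → ℕ → List ℕ
Zfuel zero       n = []
Zfuel (suc fuel) zero = []
Zfuel (suc fuel) n@(suc _) = (r n ∸ 1) ∷ Zfuel fuel (n ∸ F (r n ∸ 1))

Z : ℕ → List ℕ
Z n = Zfuel n n

π : ℕ → ℕ → ℕ
π x y = sum (map (λ e → F (2 * e)) (Z x)) + sum (map (λ j → F (B x + 2 * j ∸ 1)) (Z y))

sym : ∀ {k} → Fin k → ℕ
sym a = suc (toℕ a)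

-- right-nested code of (a₁,…,a_m), m = n+1:
-- t₁ = a_m, t_{j+1} = π(a_{m-j}, t_j); the code of a₁ ∷ rest is π(a₁, code rest)
nestedCode : ∀ {k n} → Vec (Fin k) (suc n) → ℕ
nestedCode (a ∷ []ᵥ) = sym a
nestedCode (a ∷ b ∷ v) = π (sym a) (nestedCode (b ∷ v))

decDigits : ℕ → ℕ
decDigits n = length (toNatDigits 10 n)

allSeqs : (k m : ℕ) → List (Vec (Fin k) m)
allSeqs k zero = [ []ᵥ ]
allSeqs k (suc m) = concatMap (λ a → map (a ∷_) (allSeqs k m)) (L.allFin k)

worstDigits : (k n : ℕ) → ℕ
worstDigits k n = foldr _⊔_ 0 (map (λ v → decDigits (nestedCode v)) (allSeqs k (suc n)))

{-# OPTIONS --safe #-}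
-- Each Zeckendorf sum in π x y is dominated by its top
-- term (a doubling function summed over strictly decreasing indices stays below its value at any
-- strict upper bound), so r (π x y) ≤ 3 + 2 (r x + r y), and a code of length m over {1, …, k}
-- has rank below 2^m (3 + 2 r k).  Conversely the top term of π 1 y is F (3 + 2 r y), so the
-- all-ones sequence has rank at least 2^m.  Finally c has between (r c - 1) / 8 and r c + 1
-- decimal digits, because 2^t ≤ F (2t + 1) and F e ≤ 2^e.
module Submission where

open import Defs
open import Data.Product using (∃; _×_; _,_)
open import Data.Nat
open import Data.Nat.Properties
open import Data.Nat.DivMod using (m/n<m; m*n/n≡m; /-monoˡ-≤; m<n⇒m/n≡0; m<n*o⇒m/o<n)
open import Data.Nat.Induction using (<-wellFounded-fast)
open import Data.Nat.ListAction using (sum)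
open import Data.Nat.Tactic.RingSolver using (solve-∀)
open import Data.Bool using (true; false; T)
open import Data.Empty using (⊥-elim)
open import Data.Unit using (tt)
open import Data.Sum using (inj₁; inj₂; [_,_]′)
open import Data.Fin as Fin using (Fin; toℕ)
open import Data.Fin.Properties using (toℕ<n)
open import Data.List using (List; []; _∷_; map; length)
open import Data.List.Properties using (foldr-preservesᵇ; foldr-preservesᵒ)
open import Data.List.Membership.Propositional using (_∈_)
open import Data.List.Membership.Propositional.Properties using (∈-map⁺; ∈-allFin)
open import Data.List.Relation.Unary.Any using (here)
import Data.List.Relation.Unary.Any as Any
import Data.List.Relation.Unary.Any.Properties as Any
import Data.List.Relation.Unary.All as All
import Data.List.Relation.Unary.All.Properties as All
open import Data.List.Relation.Unary.Linked using (Linked; [-]; _∷_)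
open import Data.Vec using (Vec; _∷_; replicate) renaming ([] to []ᵥ)
open import Data.Digit using (toNatDigits)
open import Function using (_∋_)
open import Induction.WellFounded using (Acc; acc; acc-inverse)
open import Relation.Binary.PropositionalEquality renaming (sym to ≡-sym)

≤-suc⇒mono-≤ : ∀ {f : ℕ → ℕ} → (∀ n → f n ≤ f (suc n)) → ∀ {m n} → m ≤ n → f m ≤ f n
≤-suc⇒mono-≤ {f} step {m} m≤n = go (≤⇒≤′ m≤n)
  where
  go : ∀ {n} → m ≤′ n → f m ≤ f n
  go ≤′-refl     = ≤-refl
  go (≤′-step p) = ≤-trans (go p) (step _)

F[1+n]>0 : ∀ n → 0 < F (suc n)
F[1+n]>0 zero    = z<s
F[1+n]>0 (suc n) = ≤-trans (F[1+n]>0 n) (m≤m+n _ _)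

F-≤-suc : ∀ n → F n ≤ F (suc n)
F-≤-suc zero    = z≤n
F-≤-suc (suc n) = m≤m+n _ _

F-mono-≤ : ∀ {m n} → m ≤ n → F m ≤ F n
F-mono-≤ = ≤-suc⇒mono-≤ F-≤-suc

F+F≤F[2+n] : ∀ n → F n + F n ≤ F (2 + n)
F+F≤F[2+n] n = +-monoˡ-≤ (F n) (F-≤-suc n)

F[2+n]≤F[1+n]+F[1+n] : ∀ n → F (2 + n) ≤ F (suc n) + F (suc n)
F[2+n]≤F[1+n]+F[1+n] n = +-monoʳ-≤ (F (suc n)) (F-≤-suc n)

F[2+n]<F[3+n] : ∀ n → F (2 + n) < F (3 + n)
F[2+n]<F[3+n] n = m<m+n (F (2 + n)) (F[1+n]>0 n)

n<F[2+n] : ∀ n → n < F (2 + n)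
n<F[2+n] zero    = z<s
n<F[2+n] (suc n) = subst (_≤ F (3 + n)) (+-comm (suc n) 1) (+-mono-≤ (n<F[2+n] n) (F[1+n]>0 n))

F≤2^n : ∀ n → F n ≤ 2 ^ n
F≤2^n zero          = z≤n
F≤2^n (suc zero)    = s≤s z≤n
F≤2^n (suc (suc n)) = begin
  F (suc n) + F n         ≤⟨ +-mono-≤ (F≤2^n (suc n)) (≤-trans (F≤2^n n) (^-monoʳ-≤ 2 (n≤1+n n))) ⟩
  2 ^ suc n + 2 ^ suc n   ≡⟨ cong (2 ^ suc n +_) (≡-sym (+-identityʳ _)) ⟩
  2 ^ suc (suc n)         ∎
  where open ≤-Reasoning

2^n≤F[1+2n] : ∀ n → 2 ^ n ≤ F (1 + 2 * n)
2^n≤F[1+2n] zero    = ≤-refl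
2^n≤F[1+2n] (suc n) = begin
  2 ^ n + (2 ^ n + 0)             ≡⟨ cong (2 ^ n +_) (+-identityʳ _) ⟩
  2 ^ n + 2 ^ n                   ≤⟨ +-mono-≤ (2^n≤F[1+2n] n) (2^n≤F[1+2n] n) ⟩
  F (1 + 2 * n) + F (1 + 2 * n)   ≤⟨ F+F≤F[2+n] (1 + 2 * n) ⟩
  F (3 + 2 * n)                   ≡⟨ cong (λ e → F (suc e)) (≡-sym (*-suc 2 n)) ⟩
  F (1 + 2 * suc n)               ∎
  where open ≤-Reasoning

rankFrom-upper : ∀ fuel e x → x < F (e + fuel) → x < F (rankFrom fuel e x)
rankFrom-upper zero       e x h = subst (λ e′ → x < F e′) (+-identityʳ e) h
rankFrom-upper (suc fuel) e x h with x <ᵇ F e in eq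
... | true  = <ᵇ⇒< x (F e) (subst T (≡-sym eq) tt)
... | false = rankFrom-upper fuel (suc e) x (subst (λ e′ → x < F e′) (+-suc e fuel) h)

rankFrom-minimal : ∀ fuel e x → (∀ e′ → e′ < e → F e′ ≤ x) →
                   ∀ e′ → e′ < rankFrom fuel e x → F e′ ≤ x
rankFrom-minimal zero       e x below = below
rankFrom-minimal (suc fuel) e x below with x <ᵇ F e in eq
... | true  = below
... | false = rankFrom-minimal fuel (suc e) x below′
  where
  below′ : ∀ e′ → e′ < suc e → F e′ ≤ x
  below′ e′ e′<1+e with m≤n⇒m<n∨m≡n (s≤s⁻¹ e′<1+e)
  ... | inj₁ e′<e = below e′ e′<e
  ... | inj₂ refl = ≮⇒≥ (λ x<Fe → subst T eq (<⇒<ᵇ x<Fe))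

x<F[r[x]] : ∀ x → x < F (r x)
x<F[r[x]] x = rankFrom-upper (x + 3) 0 x
  (≤-trans (n<F[2+n] x) (F-mono-≤ (≤-trans (n≤1+n _) (≤-reflexive (+-comm 3 x)))))

r-minimal : ∀ x e → e < r x → F e ≤ x
r-minimal x = rankFrom-minimal (x + 3) 0 x (λ _ ())

<F⇒r≤ : ∀ {x e} → x < F e → r x ≤ e
<F⇒r≤ {x} {e} x<Fe = ≮⇒≥ (λ e<r → <⇒≱ x<Fe (r-minimal x e e<r))

F≤⇒<r : ∀ {x e} → F e ≤ x → e < r x
F≤⇒<r {x} Fe≤x = ≰⇒> (λ r≤e → <⇒≱ (x<F[r[x]] x) (≤-trans (F-mono-≤ r≤e) Fe≤x))

r>0 : ∀ x → 0 < r x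
r>0 x = F≤⇒<r {x} {0} z≤n

r-mono-≤ : ∀ {x y} → x ≤ y → r x ≤ r y
r-mono-≤ {x} {y} x≤y = <F⇒r≤ (≤-<-trans x≤y (x<F[r[x]] y))

Linked-weaken-head : ∀ {m n xs} → m ≤ n → Linked _>_ (m ∷ xs) → Linked _>_ (n ∷ xs)
Linked-weaken-head _   [-]         = [-]
Linked-weaken-head m≤n (x<m ∷ xs↓) = <-≤-trans x<m m≤n ∷ xs↓

∸F[ρ∸1]<F[ρ∸1] : ∀ m ρ → 1 < ρ → m < F ρ → m ∸ F (ρ ∸ 1) < F (ρ ∸ 1)
∸F[ρ∸1]<F[ρ∸1] m (suc zero)    (s≤s ()) _
∸F[ρ∸1]<F[ρ∸1] m (suc (suc p)) _ m<F =
  m<n+o⇒m∸n<o m (F (suc p)) {{>-nonZero (F[1+n]>0 p)}} (<-≤-trans m<F (F[2+n]≤F[1+n]+F[1+n] p))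

Zfuel-decreasing : ∀ fuel n → Linked _>_ (r n ∷ Zfuel fuel n)
Zfuel-decreasing zero       n       = [-]
Zfuel-decreasing (suc fuel) zero    = [-]
Zfuel-decreasing (suc fuel) (suc n) =
  ∸-monoʳ-< z<s (r>0 (suc n)) ∷
  Linked-weaken-head
    (<F⇒r≤ (∸F[ρ∸1]<F[ρ∸1] (suc n) (r (suc n)) (F≤⇒<r {suc n} {1} (s≤s z≤n)) (x<F[r[x]] (suc n))))
    (Zfuel-decreasing fuel (suc n ∸ F (r (suc n) ∸ 1)))

Z-decreasing : ∀ n → Linked _>_ (r n ∷ Z n)
Z-decreasing n = Zfuel-decreasing n n

Doubling : (ℕ → ℕ) → Set
Doubling G = ∀ j → G j + G j ≤ G (suc j)

Doubling-sum≤ : ∀ {G} → Doubling G → ∀ {m xs} → Linked _>_ (m ∷ xs) → sum (map G xs) ≤ G m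
Doubling-sum≤ dbl [-] = z≤n
Doubling-sum≤ {G} dbl {m} {x ∷ xs} (x<m ∷ xs↓) = begin
  G x + sum (map G xs)   ≤⟨ +-monoʳ-≤ (G x) (Doubling-sum≤ dbl xs↓) ⟩
  G x + G x              ≤⟨ dbl x ⟩
  G (suc x)              ≤⟨ ≤-suc⇒mono-≤ (λ j → ≤-trans (m≤m+n (G j) (G j)) (dbl j)) x<m ⟩
  G m                    ∎
  where open ≤-Reasoning

F[c+2j]-doubling : ∀ c → Doubling (λ j → F (c + 2 * j))
F[c+2j]-doubling c j =
  subst (λ e → F (c + 2 * j) + F (c + 2 * j) ≤ F e) (index c j) (F+F≤F[2+n] (c + 2 * j))
  where
  index : ∀ c j → 2 + (c + 2 * j) ≡ c + 2 * suc j
  index = solve-∀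

F[c+2j∸1]-doubling : ∀ {c} → 0 < c → Doubling (λ j → F (c + 2 * j ∸ 1))
F[c+2j∸1]-doubling {suc c} _ = F[c+2j]-doubling c

π≤ : ∀ x y → π x y ≤ F (2 * r x) + F (B x + 2 * r y ∸ 1)
π≤ x y = +-mono-≤ (Doubling-sum≤ (F[c+2j]-doubling 0) (Z-decreasing x))
                  (Doubling-sum≤ (F[c+2j∸1]-doubling (≤-trans (r>0 x) (m≤m+n (r x) _))) (Z-decreasing y))

r-π≤ : ∀ x y → r (π x y) ≤ 3 + 2 * (r x + r y)
r-π≤ x y = <F⇒r≤ (begin-strict
  π x y                                 ≤⟨ π≤ x y ⟩
  F (2 * r x) + F (B x + 2 * r y ∸ 1)   ≤⟨ +-mono-≤ (F-mono-≤ low-index) (F-mono-≤ high-index) ⟩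
  F m + F m                             ≤⟨ F+F≤F[2+n] m ⟩
  F (2 + m)                             <⟨ F[2+n]<F[3+n] m ⟩
  F (3 + m)                             ∎)
  where
  open ≤-Reasoning
  m = 2 * (r x + r y)
  low-index : 2 * r x ≤ m
  low-index = *-monoʳ-≤ 2 (m≤m+n (r x) (r y))
  high-index : B x + 2 * r y ∸ 1 ≤ m
  high-index = ≤-trans (m∸n≤m _ 1) (≤-reflexive (≡-sym (*-distribˡ-+ 2 (r x) (r y))))

-- B 1 = 6 and the top Zeckendorf index of y is r y ∸ 1, so the top term of π 1 y is
-- F (B 1 + 2 (r y ∸ 1) ∸ 1) = F (3 + 2 r y).
F[3+2r]≤π[1,y] : ∀ y → 0 < y → F (3 + 2 * r y) ≤ π 1 y
F[3+2r]≤π[1,y] (suc y) _ =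
  ≤-trans (F-mono-≤ (top-index (r (suc y)) (r>0 (suc y)))) (≤-trans (m≤m+n _ _) (m≤n+m _ 3))
  where
  top-index : ∀ ρ → 0 < ρ → 3 + 2 * ρ ≤ 6 + 2 * (ρ ∸ 1) ∸ 1
  top-index (suc p) _ = ≤-reflexive (cong (3 +_) (*-suc 2 p))

1+n/10<1+n : ∀ n → suc n / 10 < suc n
1+n/10<1+n n = m/n<m (suc n) 10 sz<ss

-- `toNatDigits` runs a local worker that cannot be named.  The metavariable `digitsWorker`
-- is solved to it by unification in `toNatDigits-unfolding`, whose `with`s turn every argument
-- of the worker into a variable so that the problem is a pattern.  The worker's first
-- argument is the number `toNatDigits` was called on; the worker itself ignores it.
mutual
  digitsWorker : ℕ → {m : ℕ} → Acc _<_ m → List ℕ → List ℕ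
  digitsWorker = _

  private
    toNatDigits-unfolding : ∀ n → T (0 <ᵇ suc n / 10) →
      toNatDigits 10 (suc n) ≡
      digitsWorker (suc n) (acc-inverse (<-wellFounded-fast (suc n)) (1+n/10<1+n n)) (suc n % 10 ∷ [])
    toNatDigits-unfolding n _ with 0 <ᵇ suc n / 10
    ... | true with acc-inverse (<-wellFounded-fast (suc n)) (1+n/10<1+n n) | List ℕ ∋ (suc n % 10 ∷ [])
    ... | a | xs with suc n / 10
    ... | q with suc n
    ... | X = refl

10^[1+e]≤n⇒10^e≤n/10 : ∀ e {n} → 10 ^ suc e ≤ n → 10 ^ e ≤ n / 10
10^[1+e]≤n⇒10^e≤n/10 e {n} h =
  subst (_≤ n / 10) (trans (cong (_/ 10) (*-comm 10 (10 ^ e))) (m*n/n≡m (10 ^ e) 10)) (/-monoˡ-≤ 10 h)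

module _ (n₀ : ℕ) where

  digitsWorker-length> : ∀ {n} (a : Acc _<_ n) xs → length xs < length (digitsWorker n₀ a xs)
  digitsWorker-length> {zero} _ xs = ≤-refl
  digitsWorker-length> {suc n} (acc rs) xs with 0 <ᵇ suc n / 10
  ... | false = ≤-refl
  ... | true  = <-trans (n<1+n _) (digitsWorker-length> (rs (1+n/10<1+n n)) (suc n % 10 ∷ xs))

  10^e≤n⇒digitsWorker-length> : ∀ e {n} (a : Acc _<_ n) xs →
    10 ^ e ≤ n → e + length xs < length (digitsWorker n₀ a xs)
  10^e≤n⇒digitsWorker-length> zero a xs _ = digitsWorker-length> a xs
  10^e≤n⇒digitsWorker-length> (suc e) {zero} a xs h = ⊥-elim (<⇒≱ (m^n>0 10 (suc e)) h)
  10^e≤n⇒digitsWorker-length> (suc e) {suc n} (acc rs) xs h with 0 <ᵇ suc n / 10 in eq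
  ... | false = ⊥-elim (subst T eq (<⇒<ᵇ (<-≤-trans (m^n>0 10 e) (10^[1+e]≤n⇒10^e≤n/10 e h))))
  ... | true  = subst (_< length (digitsWorker n₀ a′ xs′)) (+-suc e (length xs))
                  (10^e≤n⇒digitsWorker-length> e a′ xs′ (10^[1+e]≤n⇒10^e≤n/10 e h))
    where
    a′  = rs (1+n/10<1+n n)
    xs′ = suc n % 10 ∷ xs

  n<10^[1+e]⇒digitsWorker-length≤ : ∀ e {n} (a : Acc _<_ n) xs →
    n < 10 ^ suc e → length (digitsWorker n₀ a xs) ≤ suc e + length xs
  n<10^[1+e]⇒digitsWorker-length≤ e {zero} _ xs _ = s≤s (m≤n+m _ e)
  n<10^[1+e]⇒digitsWorker-length≤ e {suc n} (acc rs) xs h with 0 <ᵇ suc n / 10 in eq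
  ... | false = s≤s (m≤n+m _ e)
  n<10^[1+e]⇒digitsWorker-length≤ zero {suc n} (acc rs) xs h | true =
    ⊥-elim (<⇒≢ (<ᵇ⇒< 0 _ (subst T (≡-sym eq) tt)) (≡-sym (m<n⇒m/n≡0 h)))
  n<10^[1+e]⇒digitsWorker-length≤ (suc e) {suc n} (acc rs) xs h | true =
    subst (length (digitsWorker n₀ a′ xs′) ≤_) (+-suc (suc e) (length xs))
      (n<10^[1+e]⇒digitsWorker-length≤ e a′ xs′ (m<n*o⇒m/o<n (subst (suc n <_) (*-comm 10 (10 ^ suc e)) h)))
    where
    a′  = rs (1+n/10<1+n n)
    xs′ = suc n % 10 ∷ xs

10^e≤n⇒e<decDigits : ∀ e n → 10 ^ e ≤ n → e < decDigits n
10^e≤n⇒e<decDigits e n h =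
  subst (_< decDigits n) (+-identityʳ e) (10^e≤n⇒digitsWorker-length> n e _ [] h)

n<10^[1+e]⇒decDigits≤1+e : ∀ e n → n < 10 ^ suc e → decDigits n ≤ suc e
n<10^[1+e]⇒decDigits≤1+e e n h =
  subst (decDigits n ≤_) (+-identityʳ (suc e)) (n<10^[1+e]⇒digitsWorker-length≤ n e _ [] h)

decDigits>0 : ∀ n → 0 < decDigits n
decDigits>0 n = digitsWorker-length> n (<-wellFounded-fast n) []

n<10^decDigits : ∀ n → n < 10 ^ decDigits n
n<10^decDigits n = ≰⇒> (λ h → <-irrefl refl (10^e≤n⇒e<decDigits (decDigits n) n h))

decDigits≤1+r : ∀ c → decDigits c ≤ suc (r c)
decDigits≤1+r c = n<10^[1+e]⇒decDigits≤1+e (r c) c (begin-strict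
  c               <⟨ x<F[r[x]] c ⟩
  F (r c)         ≤⟨ F≤2^n (r c) ⟩
  2 ^ r c         ≤⟨ ^-monoʳ-≤ 2 (n≤1+n (r c)) ⟩
  2 ^ suc (r c)   ≤⟨ ^-monoˡ-≤ (suc (r c)) (m≤m+n 2 8) ⟩
  10 ^ suc (r c)  ∎)
  where open ≤-Reasoning

r≤1+8*decDigits : ∀ c → r c ≤ suc (8 * decDigits c)
r≤1+8*decDigits c = ≮⇒≥ (λ h → <-irrefl refl (too-small h))
  where
  open ≤-Reasoning
  D = decDigits c
  too-small : suc (8 * D) < r c → c < c
  too-small h = begin-strict
    c                     <⟨ n<10^decDigits c ⟩
    10 ^ D                ≤⟨ ^-monoˡ-≤ D (m≤m+n 10 6) ⟩
    16 ^ D                ≡⟨ ^-*-assoc 2 4 D ⟩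
    2 ^ (4 * D)           ≤⟨ 2^n≤F[1+2n] (4 * D) ⟩
    F (1 + 2 * (4 * D))   ≡⟨ cong (λ e → F (suc e)) (≡-sym (*-assoc 2 4 D)) ⟩
    F (1 + 8 * D)         ≤⟨ r-minimal c _ h ⟩
    c                     ∎

rankOffset : ℕ → ℕ
rankOffset k = 3 + 2 * r k

r[sym]≤r : ∀ {k} (a : Fin k) → r (sym a) ≤ r k
r[sym]≤r a = r-mono-≤ (toℕ<n a)

rankOffset+r[nestedCode]≤ : ∀ {k n} (v : Vec (Fin k) (suc n)) →
  rankOffset k + r (nestedCode v) ≤ 2 ^ suc n * rankOffset k
rankOffset+r[nestedCode]≤ {k} (a ∷ []ᵥ) = begin
  D + r (sym a)   ≤⟨ +-monoʳ-≤ D (≤-trans (r[sym]≤r a) (≤-trans (m≤m+n (r k) _) (m≤n+m _ 3))) ⟩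
  D + D           ≡⟨ cong (D +_) (≡-sym (+-identityʳ D)) ⟩
  2 * D           ∎
  where
  open ≤-Reasoning
  D = rankOffset k
rankOffset+r[nestedCode]≤ {k} {suc n} (a ∷ b ∷ v) = begin
  D + r (π (sym a) t)               ≤⟨ +-monoʳ-≤ D r-step ⟩
  D + (3 + 2 * (r k + r t))         ≡⟨ doubling (r k) (r t) ⟩
  2 * (D + r t)                     ≤⟨ *-monoʳ-≤ 2 (rankOffset+r[nestedCode]≤ (b ∷ v)) ⟩
  2 * (2 ^ suc n * D)               ≡⟨ ≡-sym (*-assoc 2 (2 ^ suc n) D) ⟩
  2 ^ suc (suc n) * D               ∎
  where
  open ≤-Reasoning
  D = rankOffset k
  t = nestedCode (b ∷ v)
  r-step : r (π (sym a) t) ≤ 3 + 2 * (r k + r t)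
  r-step = ≤-trans (r-π≤ (sym a) t) (+-monoʳ-≤ 3 (*-monoʳ-≤ 2 (+-monoˡ-≤ (r t) (r[sym]≤r a))))
  doubling : ∀ ρ τ → (3 + 2 * ρ) + (3 + 2 * (ρ + τ)) ≡ 2 * ((3 + 2 * ρ) + τ)
  doubling = solve-∀

decDigits[nestedCode]≤ : ∀ {k n} (v : Vec (Fin k) (suc n)) →
  decDigits (nestedCode v) ≤ rankOffset k * 2 ^ suc n
decDigits[nestedCode]≤ {k} {n} v = begin
  decDigits c                ≤⟨ decDigits≤1+r c ⟩
  1 + r c                    ≤⟨ +-monoˡ-≤ (r c) (s≤s z≤n) ⟩
  rankOffset k + r c         ≤⟨ rankOffset+r[nestedCode]≤ v ⟩
  2 ^ suc n * rankOffset k   ≡⟨ *-comm (2 ^ suc n) (rankOffset k) ⟩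
  rankOffset k * 2 ^ suc n   ∎
  where
  open ≤-Reasoning
  c = nestedCode v

ones : ∀ {K} m → Vec (Fin (suc K)) m
ones m = replicate m Fin.zero

nestedCode-ones>0 : ∀ {K} n → 0 < nestedCode (ones {K} (suc n))
nestedCode-ones>0 zero    = z<s
nestedCode-ones>0 (suc n) = z<s

2^[1+n]≤r[nestedCode-ones] : ∀ {K} n → 2 ^ suc n ≤ r (nestedCode (ones {K} (suc n)))
2^[1+n]≤r[nestedCode-ones] zero    = s≤s (s≤s z≤n)
2^[1+n]≤r[nestedCode-ones] {K} (suc n) = begin
  2 * 2 ^ suc n   ≤⟨ *-monoʳ-≤ 2 (2^[1+n]≤r[nestedCode-ones] n) ⟩
  2 * r c         ≤⟨ m≤n+m _ 3 ⟩
  3 + 2 * r c     <⟨ F≤⇒<r (F[3+2r]≤π[1,y] c (nestedCode-ones>0 n)) ⟩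
  r (π 1 c)       ∎
  where
  open ≤-Reasoning
  c = nestedCode (ones {K} (suc n))

2^[1+n]≤9*decDigits[nestedCode-ones] : ∀ {K} n → 2 ^ suc n ≤ 9 * decDigits (nestedCode (ones {K} (suc n)))
2^[1+n]≤9*decDigits[nestedCode-ones] {K} n = begin
  2 ^ suc n           ≤⟨ 2^[1+n]≤r[nestedCode-ones] n ⟩
  r c                 ≤⟨ r≤1+8*decDigits c ⟩
  1 + 8 * D           ≤⟨ +-monoˡ-≤ (8 * D) (decDigits>0 c) ⟩
  9 * D               ∎
  where
  open ≤-Reasoning
  c = nestedCode (ones {K} (suc n))
  D = decDigits c

allSeqs-complete : ∀ {k m} (v : Vec (Fin k) m) → v ∈ allSeqs k m
allSeqs-complete []ᵥ     = here refl
allSeqs-complete (a ∷ v) =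
  Any.concatMap⁺ _ (Any.map (λ { refl → ∈-map⁺ (_ ∷_) (allSeqs-complete v) }) (∈-allFin a))

decDigits≤worstDigits : ∀ {k n} (v : Vec (Fin k) (suc n)) → decDigits (nestedCode v) ≤ worstDigits k n
decDigits≤worstDigits v = foldr-preservesᵒ {P = decDigits (nestedCode v) ≤_}
  (λ x y → [ m≤n⇒m≤n⊔o y , m≤n⇒m≤o⊔n x ]′) 0 _
  (inj₂ (Any.map ≤-reflexive (∈-map⁺ (λ w → decDigits (nestedCode w)) (allSeqs-complete v))))

worstDigits-lub : ∀ k n {b} → (∀ (v : Vec (Fin k) (suc n)) → decDigits (nestedCode v) ≤ b) →
                  worstDigits k n ≤ b
worstDigits-lub k n {b} bound =
  foldr-preservesᵇ {P = _≤ b} ⊔-lub z≤n (All.map⁺ (All.universal bound (allSeqs k (suc n))))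

proposition5p3 : (k : ℕ) → 2 ≤ k →
    ∃ λ a → ∃ λ b → ∃ λ N → (n : ℕ) → N ≤ n →
      (2 ^ suc n ≤ a * worstDigits k n) × (worstDigits k n ≤ b * 2 ^ suc n)
proposition5p3 zero ()
proposition5p3 (suc K) _ = 9 , rankOffset (suc K) , 0 , λ n _ → lower n , upper n
  where
  lower : ∀ n → 2 ^ suc n ≤ 9 * worstDigits (suc K) n
  lower n = ≤-trans (2^[1+n]≤9*decDigits[nestedCode-ones] n)
                    (*-monoʳ-≤ 9 (decDigits≤worstDigits (ones (suc n))))

  upper : ∀ n → worstDigits (suc K) n ≤ rankOffset (suc K) * 2 ^ suc n
  upper n = worstDigits-lub (suc K) n decDigits[nestedCode]≤
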